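{- Every $\mathcal{PCO}_\sigma$ formula $\varphi$ is provably equivalent (i.e. $\vdash\varphi\leftrightarrow\varphi'$) to a $\mathcal{PCO}_\sigma$ formula $\varphi'$ such that: (1) every consequent (right-hand argument) of an occurrence of $\Box\!\!\to$ in $\varphi'$ is a probabilistic atom; and (2) every consequent of an occurrence of $\supset$ in $\varphi'$ is a counterfactual (a formula of the form $\mathbf X=\mathbf x\,\Box\!\!\to\chi$) or a probabilistic atom.
   Context: Signature $\sigma=(\mathrm{Dom},\mathrm{Ran})$: a finite nonempty set $\mathrm{Dom}$ of variables with a fixed ordering, and finite nonempty value sets $\mathrm{Ran}(X)$; $\mathbf W_V$ lists $\mathrm{Dom}\setminus\{V\}$ in order, $\mathbf W_{XY}$ lists $\mathrm{Dom}\setminus\{X,Y\}$. $\mathbf X=\mathbf x$ abbreviates $X_1=x_1\wedge\dots\wedge X_n=x_n$; it is consistent unless some variable is assigned two distinct values. Language $\mathcal{CO}_\sigma$: $\alpha::= Y=y\mid Y\neq y\mid\alpha\wedge\alpha\mid\alpha\supset\alpha\mid \mathbf X=\mathbf x\,\Box\!\!\to\alpha$. Abbreviations: $\top:=X=x\,\Box\!\!\to X=x$, $\bot:=X=x\,\Box\!\!\to X\neq x$ (fixed $X,x$), $\neg\alpha:=\alpha\supset\bot$, $\alpha\vee\beta:=\neg(\neg\alpha\wedge\neg\beta)$, $\alpha\equiv\beta:=(\alpha\supset\beta)\wedge(\beta\supset\alpha)$. Language $\mathcal{PCO}_\sigma$: $\varphi::=\eta\mid\varphi\wedge\varphi\mid\varphi\sqcup\varphi\mid\alpha\supset\varphi\mid\mathbf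 X=\mathbf x\,\Box\!\!\to\varphi$, $\alpha\in\mathcal{CO}$, $\eta$ atomic: a literal $Y=y$, $Y\neq y$ or a probabilistic atom $\Pr(\alpha)\geq\epsilon$, $\Pr(\alpha)>\epsilon$, $\Pr(\alpha)\geq\Pr(\beta)$, $\Pr(\alpha)>\Pr(\beta)$ ($\epsilon\in[0,1]\cap\mathbb Q$). Abbreviations: $\Pr(\alpha)\leq\epsilon:=\Pr(\neg\alpha)\geq1-\epsilon$; $\Pr(\alpha)<\epsilon:=\Pr(\neg\alpha)>1-\epsilon$; $\Pr(\alpha)=\epsilon:=\Pr(\alpha)\geq\epsilon\wedge\Pr(\alpha)\leq\epsilon$; $\Pr(\alpha)\neq\epsilon:=\Pr(\alpha)>\epsilon\sqcup\Pr(\alpha)<\epsilon$. The operation $\varphi\mapsto\varphi^C$: $(\Pr(\alpha)\geq\epsilon)^C=\Pr(\alpha)<\epsilon$ and vice versa; $(\Pr(\alpha)>\epsilon)^C=\Pr(\alpha)\leq\epsilon$ and vice versa; $(\Pr(\alpha)=\epsilon)^C=\Pr(\alpha)\neq\epsilon$ and vice versa; $(\Pr(\alpha)\geq\Pr(\beta))^C=\Pr(\beta)>\Pr(\alpha)$ and vice versa; $\bot^C=\top$ and vice versa; $(X=x)^C=\Pr(X=x)<1$; $(X\neq x)^C=\Pr(X\neq x)<1$; $(\psi\wedge\chi)^C=\psi^C\sqcup\chi^C$; $(\psi\sqcup\chi)^C=\psi^C\wedge\chi^C$; $(\alpha\supset\chi)^C=\Pr(\alpha)>0\wedge\alpha\supset\chi^C$;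 $(\mathbf X=\mathbf x\,\Box\!\!\to\chi)^C=\mathbf X=\mathbf x\,\Box\!\!\to\chi^C$. $\psi\to\chi:=\psi^C\sqcup\chi$, $\psi\leftrightarrow\chi:=(\psi\to\chi)\wedge(\chi\to\psi)$; $\mathbf Y\neq\mathbf y:=Y_1\neq y_1\sqcup\dots\sqcup Y_n\neq y_n$; $\bigvee,\bigsqcup,\bigwedge$ iterate $\vee,\sqcup,\wedge$. Auxiliary formulas: $\varphi_{DC(X,Y)}:=\bigvee_{x\neq x',\,y\neq y',\,\mathbf w\in\mathrm{Ran}(\mathbf W_{XY})}[((\mathbf W_{XY}=\mathbf w\wedge X=x)\Box\!\!\to Y=y)\wedge((\mathbf W_{XY}=\mathbf w\wedge X=x')\Box\!\!\to Y=y')]$; $\varphi_{End(Y)}:=\bigsqcup_{X\in\mathbf W_Y}\varphi_{DC(X,Y)}$; $X\leadsto Y:=\bigvee_{\mathbf Z\subseteq\mathrm{Dom}\setminus\{X\},\,\mathbf z,\,x\neq x',\,y\neq y'}[((\mathbf Z=\mathbf z\wedge X=x)\Box\!\!\to Y=y)\wedge((\mathbf Z=\mathbf z\wedge X=x')\Box\!\!\to Y=y')]$. Deduction system ($\alpha,\beta$ in $\mathcal{CO}$; $\psi,\chi,\varphi,\theta$ in $\mathcal{PCO}$; $\delta,\epsilon\in[0,1]\cap\mathbb Q$). Axioms: T1: substitution instances of classical tautologies in $\wedge,\sqcup,\to,{}^C,\top,\bot$. T2: $\mathcal{CO}$ instances of classical tautologies in $\wedge,\vee,\supset,\neg,\top,\bot$.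 P1: $\alpha\leftrightarrow\Pr(\alpha)=1$. P2: $\Pr(\alpha)\geq0$. P3: $(\Pr(\alpha)=\delta\wedge\Pr(\beta)=\epsilon\wedge\Pr(\alpha\wedge\beta)=0)\to\Pr(\alpha\vee\beta)=\delta+\epsilon$ ($\delta+\epsilon\leq1$). P3b: $\Pr(\alpha)\geq\epsilon\wedge\Pr(\alpha\wedge\beta)=0\to\Pr(\beta)\leq1-\epsilon$. P4: $\Pr(\alpha)\leq\epsilon\to\Pr(\alpha)<\delta$ ($\delta>\epsilon$). P5: $\Pr(\alpha)<\epsilon\to\Pr(\alpha)\leq\epsilon$. P6: $\Pr(\alpha\equiv\beta)=1\to(\Pr(\alpha)=\epsilon\to\Pr(\beta)=\epsilon)$. P6b: $\Pr(\alpha\supset\beta)=1\to(\Pr(\alpha)=\epsilon\to\Pr(\beta)\geq\epsilon)$. CP1: $(\Pr(\alpha)=\delta\wedge\Pr(\beta)=\epsilon)\to\Pr(\alpha)\geq\Pr(\beta)$ ($\delta\geq\epsilon$). CP2: same with $>$ ($\delta>\epsilon$). O1: $\Pr(\alpha)=0\to(\alpha\supset\psi)$. O1b: $(\alpha\supset\bot)\to\Pr(\alpha)=0$. O2: $(\Pr(\alpha)=\delta\wedge\Pr(\alpha\wedge\beta)=\epsilon)\to(\alpha\supset\Pr(\beta)=\frac{\epsilon}{\delta})$ ($\delta\neq0$). O3: $(\alpha\supset\Pr(\beta)=\epsilon)\to(\Pr(\alpha)=\delta\leftrightarrow\Pr(\alpha\wedge\beta)=\epsilon\cdot\delta)$ ($\epsilon\neq0$).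 O4: $(\alpha\supset\psi)\to(\alpha\to\psi)$. O5$_\wedge$: $\alpha\supset(\psi\wedge\chi)\leftrightarrow(\alpha\supset\psi)\wedge(\alpha\supset\chi)$. O5$_\sqcup$: same with $\sqcup$. O5$_\supset$: $\alpha\supset(\beta\supset\chi)\leftrightarrow(\alpha\wedge\beta)\supset\chi$. A1: $\mathbf Y=\mathbf y\to\mathbf Y\neq\mathbf y'$ ($\mathbf y\neq\mathbf y'$). A2: $X\neq x\leftrightarrow(X=x\supset\bot)$. A3: $\bigvee_{\mathbf y\in\mathrm{Ran}(\mathbf Y)}\mathbf Y=\mathbf y$. C1: $(\mathbf X=\mathbf x\Box\!\!\to(\psi\wedge\chi))\leftrightarrow((\mathbf X=\mathbf x\Box\!\!\to\psi)\wedge(\mathbf X=\mathbf x\Box\!\!\to\chi))$. C2: same with $\sqcup$. C3: $(\mathbf X=\mathbf x\Box\!\!\to(\alpha\supset\chi))\leftrightarrow((\mathbf X=\mathbf x\Box\!\!\to\alpha)\supset(\mathbf X=\mathbf x\Box\!\!\to\chi))$. C4: $(\mathbf X=\mathbf x\Box\!\!\to(\mathbf Y=\mathbf y\Box\!\!\to\chi))\to((\mathbf X'=\mathbf x'\wedge\mathbf Y=\mathbf y)\Box\!\!\to\chi)$, $\mathbf X'=\mathbf X\setminus\mathbf Y$, $\mathbf x'$ corresponding values, $\mathbf X=\mathbf x$ consistent. C4b: $((\mathbf X=\mathbf x\wedge\mathbf Y=\mathbf y)\Box\!\!\to\chi)\to(\mathbf X=\mathbf x\Box\!\!\to(\mathbf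 Y=\mathbf y\Box\!\!\to\chi))$. C5: $(\mathbf X=\mathbf x\Box\!\!\to\bot)\to\psi$ ($\mathbf X=\mathbf x$ consistent). C6: $(\mathbf X=\mathbf x\wedge Y=y)\Box\!\!\to Y=y$. C7: $(\mathbf X=\mathbf x\wedge\gamma)\to(\mathbf X=\mathbf x\Box\!\!\to\gamma)$, $\gamma\in\mathcal{PCO}$ without $\Box\!\!\to$. C8: $(\mathbf X=\mathbf x\Box\!\!\to\Pr(\alpha)\rhd\epsilon)\leftrightarrow\Pr(\mathbf X=\mathbf x\Box\!\!\to\alpha)\rhd\epsilon$ ($\rhd\in\{\geq,>\}$). C8b: $(\mathbf X=\mathbf x\Box\!\!\to\Pr(\alpha)\rhd\Pr(\beta))\leftrightarrow\Pr(\mathbf X=\mathbf x\Box\!\!\to\alpha)\rhd\Pr(\mathbf X=\mathbf x\Box\!\!\to\beta)$. C9: $\varphi_{End(Y)}\to(\mathbf W_Y=\mathbf w\Box\!\!\to\bigsqcup_{y}Y=y)$. C10: $(\varphi_{End(Y)})^C\to(Y=y\supset(\mathbf W_Y=\mathbf w\Box\!\!\to Y=y))$. C11: $(X_1\leadsto X_2\wedge\dots\wedge X_{n-1}\leadsto X_n)\to(X_n\leadsto X_1)^C$ ($n>1$). Rules: MP (from $\psi$, $\psi\to\chi$ infer $\chi$); Rep (from $\vdash\varphi$, $\vdash\theta\leftrightarrow\theta'$ infer $\vdash\varphi[\theta'/\theta]$ if well-formed); $\bot^\omega$ (from $\psi\to\Pr(\alpha)\neq\epsilon$ for all $\epsilon\in[0,1]\cap\mathbb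 Q$ infer $\psi\to\bot$); Mon$_\supset$ (from $\vdash\psi\to\chi$ infer $\vdash(\alpha\supset\psi)\to(\alpha\supset\chi)$); $\to$to$\supset$ (from $\vdash\alpha\to\psi$ infer $\vdash\alpha\supset\psi$); $\supset^\omega$ (from $\psi\to(\Pr(\alpha\wedge\beta)=\delta\epsilon\leftrightarrow\Pr(\alpha)=\epsilon)$ for all $\epsilon\in(0,1]\cap\mathbb Q$ infer $\psi\to(\alpha\supset\Pr(\beta)=\delta)$); Mon$_{\Box\!\to}$ (from $\vdash\psi\to\chi$ infer $\vdash(\mathbf X=\mathbf x\Box\!\!\to\psi)\to(\mathbf X=\mathbf x\Box\!\!\to\chi)$). $\Gamma\vdash\varphi$ iff there is a sequence indexed by ordinals $\leq\kappa$ (countable) ending in $\varphi$, each term an axiom, in $\Gamma$, or obtained from earlier terms by a rule, where Rep, Mon$_\supset$, Mon$_{\Box\!\to}$, $\to$to$\supset$ apply only to theorems (formulas derivable from $\emptyset$). -}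

module Defs where

open import Data.Nat using (ℕ; zero; suc)
open import Data.Fin using (Fin; zero; suc)
open import Data.Fin.Properties using (_≟_)
open import Data.Bool using (Bool; true; false; not) renaming (_∧_ to _and_; _∨_ to _or_)
open import Data.Product using (Σ; _,_; _×_; proj₁; proj₂)
open import Data.Sum using (_⊎_)
open import Data.List using (List; []; _∷_; _++_; map; concatMap; allFin; filter)
open import Data.List.Membership.Propositional using (_∈_)
open import Data.List.Relation.Unary.Any using (Any; any?)
open import Data.Unit using (⊤)
open import Data.Empty using (⊥)
open import Relation.Nullary using (¬_; ¬?; does)
open import Relation.Nullary.Decidable using (_×-dec_)
open import Relation.Binary.PropositionalEquality using (_≡_; _≢_; refl; subst)
open import Data.Rational using (ℚ; 0ℚ; 1ℚ; _≤_; _<_; -_; _*_) renaming (_+_ to _+ℚ_; _-_ to _-ℚ_)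
import Data.Rational.Properties as ℚP
import Data.Rational

-- Signatures: Dom = Fin (suc n) (ordered by the order of Fin),
-- Ran(X) = Fin (suc (ran X)) (finite, nonempty).

record Signature : Set where
  field
    n   : ℕ
    ran : Fin (suc n) → ℕ
open Signature public

Var : Signature → Set
Var σ = Fin (suc (n σ))

Val : (σ : Signature) → Var σ → Set
Val σ X = Fin (suc (ran σ X))

-- an "X = x" antecedent: a (possibly empty) list of variable/value pairs
Asg : Signature → Set
Asg σ = List (Σ (Var σ) (Val σ))

Consistent : {σ : Signature} → Asg σ → Set
Consistent {σ} A = ∀ {v : Var σ} {a b : Val σ v} → (v , a) ∈ A → (v , b) ∈ A → a ≡ b

record Prob : Set where
  constructor prob
  field
    val : ℚ
    lo  : 0ℚ ≤ val
    hi  : val ≤ 1ℚ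
open Prob public

p0 : Prob
p0 = prob 0ℚ (ℚP.≤-refl {0ℚ}) (ℚP.<⇒≤ (ℚP.positive⁻¹ 1ℚ))

p1 : Prob
p1 = prob 1ℚ (ℚP.<⇒≤ (ℚP.positive⁻¹ 1ℚ)) (ℚP.≤-refl {1ℚ})

1-_ : Prob → Prob
1- (prob e l h) = prob (1ℚ -ℚ e) lo' hi'
  where
  lo' : 0ℚ ≤ 1ℚ -ℚ e
  lo' = subst (_≤ 1ℚ -ℚ e) (ℚP.+-inverseʳ 1ℚ) (ℚP.+-monoʳ-≤ 1ℚ (ℚP.neg-antimono-≤ h))
  hi' : 1ℚ -ℚ e ≤ 1ℚ
  hi' = subst (1ℚ -ℚ e ≤_) (ℚP.+-identityʳ 1ℚ) (ℚP.+-monoʳ-≤ 1ℚ (ℚP.neg-antimono-≤ l))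

_·ᵖ_ : Prob → Prob → Prob
prob d l h ·ᵖ prob e l' h' = prob (d * e) lo' hi'
  where
  instance
    nnd : Data.Rational.NonNegative d
    nnd = Data.Rational.nonNegative l
    nne : Data.Rational.NonNegative e
    nne = Data.Rational.nonNegative l'
  lo' : 0ℚ ≤ d * e
  lo' = ℚP.nonNegative⁻¹ (d * e) {{ℚP.nonNeg*nonNeg⇒nonNeg d e}}
  hi' : d * e ≤ 1ℚ
  hi' = ℚP.≤-trans (subst (d * e ≤_) (ℚP.*-identityʳ d) (ℚP.*-monoˡ-≤-nonNeg d h')) h

infixr 6 _∧c_
infixr 4 _⊃c_
infixr 5 _□→c_

data CO (σ : Signature) : Set where
  _≐_   : (Y : Var σ) → Val σ Y → CO σ
  _≠̇_   : (Y : Var σ) → Val σ Y → CO σ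
  _∧c_  : CO σ → CO σ → CO σ
  _⊃c_  : CO σ → CO σ → CO σ
  _□→c_ : Asg σ → CO σ → CO σ

infixr 6 _∧_
infixr 5 _⊔_
infixr 4 _⊃_
infixr 5 _□→_

data PCO (σ : Signature) : Set where
  lit=  : (Y : Var σ) → Val σ Y → PCO σ
  lit≠  : (Y : Var σ) → Val σ Y → PCO σ
  Pr≥   : CO σ → Prob → PCO σ
  Pr>   : CO σ → Prob → PCO σ
  PrGe  : CO σ → CO σ → PCO σ
  PrGt  : CO σ → CO σ → PCO σ
  _∧_   : PCO σ → PCO σ → PCO σ
  _⊔_   : PCO σ → PCO σ → PCO σ
  _⊃_   : CO σ → PCO σ → PCO σ
  _□→_  : Asg σ → PCO σ → PCO σ

module _ {σ : Signature} where

  emb : CO σ → PCO σ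
  emb (Y ≐ y) = lit= Y y
  emb (Y ≠̇ y) = lit≠ Y y
  emb (α ∧c β) = emb α ∧ emb β
  emb (α ⊃c β) = α ⊃ emb β
  emb (A □→c β) = A □→ emb β

  ⊤c ⊥c : CO σ
  ⊤c = ((zero , zero) ∷ []) □→c (zero ≐ zero)
  ⊥c = ((zero , zero) ∷ []) □→c (zero ≠̇ zero)

  ⊤ᵖ ⊥ᵖ : PCO σ
  ⊤ᵖ = emb ⊤c
  ⊥ᵖ = emb ⊥c

  ¬c_ : CO σ → CO σ
  ¬c α = α ⊃c ⊥c

  _∨c_ _≡c_ : CO σ → CO σ → CO σ
  α ∨c β = ¬c ((¬c α) ∧c (¬c β))
  α ≡c β = (α ⊃c β) ∧c (β ⊃c α)

  ⋀c : List (CO σ) → CO σ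
  ⋀c [] = ⊤c
  ⋀c (a ∷ []) = a
  ⋀c (a ∷ as@(_ ∷ _)) = a ∧c ⋀c as

  ⋁c : List (CO σ) → CO σ
  ⋁c [] = ⊥c
  ⋁c (a ∷ []) = a
  ⋁c (a ∷ as@(_ ∷ _)) = a ∨c ⋁c as

  ⋀ᵖ : List (PCO σ) → PCO σ
  ⋀ᵖ [] = ⊤ᵖ
  ⋀ᵖ (a ∷ []) = a
  ⋀ᵖ (a ∷ as@(_ ∷ _)) = a ∧ ⋀ᵖ as

  ⨆ᵖ : List (PCO σ) → PCO σ
  ⨆ᵖ [] = ⊥ᵖ
  ⨆ᵖ (a ∷ []) = a
  ⨆ᵖ (a ∷ as@(_ ∷ _)) = a ⊔ ⨆ᵖ as

  eqC : Asg σ → CO σ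
  eqC A = ⋀c (map (λ p → proj₁ p ≐ proj₂ p) A)

  eqP : Asg σ → PCO σ
  eqP A = ⋀ᵖ (map (λ p → lit= (proj₁ p) (proj₂ p)) A)

  Pr≤ Pr< Pr≐ Pr≠ : CO σ → Prob → PCO σ
  Pr≤ α ε = Pr≥ (¬c α) (1- ε)
  Pr< α ε = Pr> (¬c α) (1- ε)
  Pr≐ α ε = Pr≥ α ε ∧ Pr≤ α ε
  Pr≠ α ε = Pr> α ε ⊔ Pr< α ε

  _ᶜ : PCO σ → PCO σ
  lit= Y y ᶜ = Pr< (Y ≐ y) p1
  lit≠ Y y ᶜ = Pr< (Y ≠̇ y) p1
  Pr≥ α ε ᶜ = Pr< α ε
  Pr> α ε ᶜ = Pr≤ α ε
  PrGe α β ᶜ = PrGt β α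
  PrGt α β ᶜ = PrGe β α
  (ψ ∧ χ) ᶜ = (ψ ᶜ) ⊔ (χ ᶜ)
  (ψ ⊔ χ) ᶜ = (ψ ᶜ) ∧ (χ ᶜ)
  (α ⊃ χ) ᶜ = Pr> α p0 ∧ (α ⊃ (χ ᶜ))
  (A □→ χ) ᶜ = A □→ (χ ᶜ)

  infixr 3 _⇒_
  infix 2 _⇔_
  _⇒_ _⇔_ : PCO σ → PCO σ → PCO σ
  ψ ⇒ χ = (ψ ᶜ) ⊔ χ
  ψ ⇔ χ = (ψ ⇒ χ) ∧ (χ ⇒ ψ)

  vars : List (Var σ)
  vars = allFin (suc (n σ))

  W₁ : Var σ → List (Var σ)
  W₁ V = filter (λ v → ¬? (v ≟ V)) vars

  W₂ : Var σ → Var σ → List (Var σ)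
  W₂ X Y = filter (λ v → ¬? (v ≟ X) ×-dec ¬? (v ≟ Y)) vars

  assignments : List (Var σ) → List (Asg σ)
  assignments [] = [] ∷ []
  assignments (v ∷ vs) =
    concatMap (λ a → map (λ x → (v , x) ∷ a) (allFin (suc (ran σ v)))) (assignments vs)

  distinctPairs : (k : ℕ) → List (Fin k × Fin k)
  distinctPairs k =
    concatMap (λ a → concatMap (λ b → if′ does (a ≟ b) then [] else ((a , b) ∷ [])) (allFin k)) (allFin k)
    where
    if′_then_else_ : {A : Set} → Bool → A → A → A
    if′ true then x else y = x
    if′ false then x else y = y

  sublists : List (Var σ) → List (List (Var σ))
  sublists [] = [] ∷ []
  sublists (v ∷ vs) = sublists vs ++ map (v ∷_) (sublists vs)

  twoCF : (Z : Asg σ) (X Y : Var σ) → List (CO σ)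
  twoCF Z X Y =
    concatMap (λ xx → map (λ yy →
        ((Z ++ ((X , proj₁ xx) ∷ [])) □→c (Y ≐ proj₁ yy))
        ∧c ((Z ++ ((X , proj₂ xx) ∷ [])) □→c (Y ≐ proj₂ yy)))
      (distinctPairs (suc (ran σ Y))))
    (distinctPairs (suc (ran σ X)))

  φDC : Var σ → Var σ → CO σ
  φDC X Y = ⋁c (concatMap (λ w → twoCF w X Y) (assignments (W₂ X Y)))

  φEnd : Var σ → PCO σ
  φEnd Y = ⨆ᵖ (map (λ X → emb (φDC X Y)) (W₁ Y))

  _⇝_ : Var σ → Var σ → CO σ
  X ⇝ Y = ⋁c (concatMap (λ Z → concatMap (λ z → twoCF z X Y) (assignments Z)) (sublists (W₁ X)))

  -- W_V = w, for w ∈ Ran(W_V) given as a total value assignment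
  restrictTo : List (Var σ) → ((v : Var σ) → Val σ v) → Asg σ
  restrictTo Vs w = map (λ v → v , w v) Vs

  minusVars : Asg σ → Asg σ → Asg σ
  minusVars A B = filter (λ p → ¬? (any? (λ q → proj₁ p ≟ proj₁ q) B)) A

  NoCFc : CO σ → Set
  NoCFc (Y ≐ y) = ⊤
  NoCFc (Y ≠̇ y) = ⊤
  NoCFc (α ∧c β) = NoCFc α × NoCFc β
  NoCFc (α ⊃c β) = NoCFc α × NoCFc β
  NoCFc (A □→c β) = ⊥

  NoCF : PCO σ → Set
  NoCF (lit= Y y) = ⊤
  NoCF (lit≠ Y y) = ⊤
  NoCF (Pr≥ α ε) = NoCFc α
  NoCF (Pr> α ε) = NoCFc α
  NoCF (PrGe α β) = NoCFc α × NoCFc β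
  NoCF (PrGt α β) = NoCFc α × NoCFc β
  NoCF (ψ ∧ χ) = NoCF ψ × NoCF χ
  NoCF (ψ ⊔ χ) = NoCF ψ × NoCF χ
  NoCF (α ⊃ χ) = NoCFc α × NoCF χ
  NoCF (A □→ χ) = ⊥

  chain : Var σ → List (Var σ) → PCO σ
  chain X [] = ⊤ᵖ
  chain X (Y ∷ []) = emb (X ⇝ Y)
  chain X (Y ∷ Ys@(_ ∷ _)) = emb (X ⇝ Y) ∧ chain Y Ys

  last : Var σ → List (Var σ) → Var σ
  last X [] = X
  last X (Y ∷ Ys) = last Y Ys

data Prop₁ : Set where
  pv : ℕ → Prop₁
  _p∧_ _p⊔_ _p→_ : Prop₁ → Prop₁ → Prop₁
  pC : Prop₁ → Prop₁
  p⊤ p⊥ : Prop₁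

ev₁ : (ℕ → Bool) → Prop₁ → Bool
ev₁ v (pv i) = v i
ev₁ v (a p∧ b) = ev₁ v a and ev₁ v b
ev₁ v (a p⊔ b) = ev₁ v a or ev₁ v b
ev₁ v (a p→ b) = not (ev₁ v a) or ev₁ v b
ev₁ v (pC a) = not (ev₁ v a)
ev₁ v p⊤ = true
ev₁ v p⊥ = false

Taut₁ : Prop₁ → Set
Taut₁ F = ∀ v → ev₁ v F ≡ true

data Prop₂ : Set where
  qv : ℕ → Prop₂
  _q∧_ _q∨_ _q⊃_ : Prop₂ → Prop₂ → Prop₂
  q¬ : Prop₂ → Prop₂
  q⊤ q⊥ : Prop₂

ev₂ : (ℕ → Bool) → Prop₂ → Bool
ev₂ v (qv i) = v i
ev₂ v (a q∧ b) = ev₂ v a and ev₂ v b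
ev₂ v (a q∨ b) = ev₂ v a or ev₂ v b
ev₂ v (a q⊃ b) = not (ev₂ v a) or ev₂ v b
ev₂ v (q¬ a) = not (ev₂ v a)
ev₂ v q⊤ = true
ev₂ v q⊥ = false

Taut₂ : Prop₂ → Set
Taut₂ F = ∀ v → ev₂ v F ≡ true

module _ {σ : Signature} where

  inst₁ : (ℕ → PCO σ) → Prop₁ → PCO σ
  inst₁ s (pv i) = s i
  inst₁ s (a p∧ b) = inst₁ s a ∧ inst₁ s b
  inst₁ s (a p⊔ b) = inst₁ s a ⊔ inst₁ s b
  inst₁ s (a p→ b) = inst₁ s a ⇒ inst₁ s b
  inst₁ s (pC a) = inst₁ s a ᶜ
  inst₁ s p⊤ = ⊤ᵖ
  inst₁ s p⊥ = ⊥ᵖ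

  inst₂ : (ℕ → CO σ) → Prop₂ → CO σ
  inst₂ s (qv i) = s i
  inst₂ s (a q∧ b) = inst₂ s a ∧c inst₂ s b
  inst₂ s (a q∨ b) = inst₂ s a ∨c inst₂ s b
  inst₂ s (a q⊃ b) = inst₂ s a ⊃c inst₂ s b
  inst₂ s (q¬ a) = ¬c inst₂ s a
  inst₂ s q⊤ = ⊤c
  inst₂ s q⊥ = ⊥c

module _ {σ : Signature} where

  -- inside a CO formula (only possible when θ, θ' are CO formulas a, a')
  data RepC (a a' : CO σ) : CO σ → CO σ → Set where
    here : RepC a a' a a'
    ∧l   : ∀ {α α' β} → RepC a a' α α' → RepC a a' (α ∧c β) (α' ∧c β)
    ∧r   : ∀ {α β β'} → RepC a a' β β' → RepC a a' (α ∧c β) (α ∧c β')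
    ⊃l   : ∀ {α α' β} → RepC a a' α α' → RepC a a' (α ⊃c β) (α' ⊃c β)
    ⊃r   : ∀ {α β β'} → RepC a a' β β' → RepC a a' (α ⊃c β) (α ⊃c β')
    □→r  : ∀ {A β β'} → RepC a a' β β' → RepC a a' (A □→c β) (A □→c β')

  data RepP (θ θ' : PCO σ) : PCO σ → PCO σ → Set where
    here : RepP θ θ' θ θ'
    ∧l   : ∀ {φ φ' ψ} → RepP θ θ' φ φ' → RepP θ θ' (φ ∧ ψ) (φ' ∧ ψ)
    ∧r   : ∀ {φ ψ ψ'} → RepP θ θ' ψ ψ' → RepP θ θ' (φ ∧ ψ) (φ ∧ ψ')
    ⊔l   : ∀ {φ φ' ψ} → RepP θ θ' φ φ' → RepP θ θ' (φ ⊔ ψ) (φ' ⊔ ψ)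
    ⊔r   : ∀ {φ ψ ψ'} → RepP θ θ' ψ ψ' → RepP θ θ' (φ ⊔ ψ) (φ ⊔ ψ')
    ⊃r   : ∀ {α ψ ψ'} → RepP θ θ' ψ ψ' → RepP θ θ' (α ⊃ ψ) (α ⊃ ψ')
    □→r  : ∀ {A ψ ψ'} → RepP θ θ' ψ ψ' → RepP θ θ' (A □→ ψ) (A □→ ψ')
    ⊃l   : ∀ {a a' α α' ψ} → emb a ≡ θ → emb a' ≡ θ' → RepC a a' α α'
           → RepP θ θ' (α ⊃ ψ) (α' ⊃ ψ)
    pr≥  : ∀ {a a' α α' ε} → emb a ≡ θ → emb a' ≡ θ' → RepC a a' α α'
           → RepP θ θ' (Pr≥ α ε) (Pr≥ α' ε)
    pr>  : ∀ {a a' α α' ε} → emb a ≡ θ → emb a' ≡ θ' → RepC a a' α α'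
           → RepP θ θ' (Pr> α ε) (Pr> α' ε)
    prGeˡ : ∀ {a a' α α' β} → emb a ≡ θ → emb a' ≡ θ' → RepC a a' α α'
           → RepP θ θ' (PrGe α β) (PrGe α' β)
    prGeʳ : ∀ {a a' α β β'} → emb a ≡ θ → emb a' ≡ θ' → RepC a a' β β'
           → RepP θ θ' (PrGe α β) (PrGe α β')
    prGtˡ : ∀ {a a' α α' β} → emb a ≡ θ → emb a' ≡ θ' → RepC a a' α α'
           → RepP θ θ' (PrGt α β) (PrGt α' β)
    prGtʳ : ∀ {a a' α β β'} → emb a ≡ θ → emb a' ≡ θ' → RepC a a' β β'
           → RepP θ θ' (PrGt α β) (PrGt α β')

-- The deduction system (derivability from the empty set of premises).
-- Derivations are well-founded, possibly infinitely branching trees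
-- (infinitary rules ⊥^ω and ⊃^ω).

infix 1 ⊢_

data ⊢_ {σ : Signature} : PCO σ → Set where
  T1 : ∀ (F : Prop₁) (s : ℕ → PCO σ) → Taut₁ F → ⊢ inst₁ s F
  T2 : ∀ (F : Prop₂) (s : ℕ → CO σ) → Taut₂ F → ⊢ emb (inst₂ s F)
  P1 : ∀ α → ⊢ (emb α ⇔ Pr≐ α p1)
  P2 : ∀ α → ⊢ Pr≥ α p0
  P3 : ∀ α β (δ ε γ : Prob) → val γ ≡ val δ +ℚ val ε →
       ⊢ ((Pr≐ α δ ∧ Pr≐ β ε ∧ Pr≐ (α ∧c β) p0) ⇒ Pr≐ (α ∨c β) γ)
  P3b : ∀ α β ε → ⊢ ((Pr≥ α ε ∧ Pr≐ (α ∧c β) p0) ⇒ Pr≤ β (1- ε))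
  P4 : ∀ α (ε δ : Prob) → val ε < val δ → ⊢ (Pr≤ α ε ⇒ Pr< α δ)
  P5 : ∀ α ε → ⊢ (Pr< α ε ⇒ Pr≤ α ε)
  P6 : ∀ α β ε → ⊢ (Pr≐ (α ≡c β) p1 ⇒ (Pr≐ α ε ⇒ Pr≐ β ε))
  P6b : ∀ α β ε → ⊢ (Pr≐ (α ⊃c β) p1 ⇒ (Pr≐ α ε ⇒ Pr≥ β ε))
  CP1 : ∀ α β (δ ε : Prob) → val ε ≤ val δ → ⊢ ((Pr≐ α δ ∧ Pr≐ β ε) ⇒ PrGe α β)
  CP2 : ∀ α β (δ ε : Prob) → val ε < val δ → ⊢ ((Pr≐ α δ ∧ Pr≐ β ε) ⇒ PrGt α β)
  O1 : ∀ α ψ → ⊢ (Pr≐ α p0 ⇒ (α ⊃ ψ))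
  O1b : ∀ α → ⊢ ((α ⊃ ⊥ᵖ) ⇒ Pr≐ α p0)
  -- γ = ε / δ  (expressed as γ · δ = ε, δ ≠ 0)
  O2 : ∀ α β (δ ε γ : Prob) → val δ ≢ 0ℚ → val γ * val δ ≡ val ε →
       ⊢ ((Pr≐ α δ ∧ Pr≐ (α ∧c β) ε) ⇒ (α ⊃ Pr≐ β γ))
  O3 : ∀ α β (ε δ : Prob) → val ε ≢ 0ℚ →
       ⊢ ((α ⊃ Pr≐ β ε) ⇒ (Pr≐ α δ ⇔ Pr≐ (α ∧c β) (ε ·ᵖ δ)))
  O4 : ∀ α ψ → ⊢ ((α ⊃ ψ) ⇒ (emb α ⇒ ψ))
  O5∧ : ∀ α ψ χ → ⊢ ((α ⊃ (ψ ∧ χ)) ⇔ ((α ⊃ ψ) ∧ (α ⊃ χ)))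
  O5⊔ : ∀ α ψ χ → ⊢ ((α ⊃ (ψ ⊔ χ)) ⇔ ((α ⊃ ψ) ⊔ (α ⊃ χ)))
  O5⊃ : ∀ α β χ → ⊢ ((α ⊃ (β ⊃ χ)) ⇔ ((α ∧c β) ⊃ χ))
  A1 : ∀ (T : List (Σ (Var σ) (λ v → Val σ v × Val σ v))) →
       Any (λ t → proj₁ (proj₂ t) ≢ proj₂ (proj₂ t)) T →
       ⊢ (eqP (map (λ t → proj₁ t , proj₁ (proj₂ t)) T)
           ⇒ ⨆ᵖ (map (λ t → lit≠ (proj₁ t) (proj₂ (proj₂ t))) T))
  A2 : ∀ X x → ⊢ (lit≠ X x ⇔ ((X ≐ x) ⊃ ⊥ᵖ))
  A3 : ∀ (Ys : List (Var σ)) → ⊢ emb (⋁c (map eqC (assignments Ys)))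
  C1 : ∀ A ψ χ → ⊢ ((A □→ (ψ ∧ χ)) ⇔ ((A □→ ψ) ∧ (A □→ χ)))
  C2 : ∀ A ψ χ → ⊢ ((A □→ (ψ ⊔ χ)) ⇔ ((A □→ ψ) ⊔ (A □→ χ)))
  C3 : ∀ A α χ → ⊢ ((A □→ (α ⊃ χ)) ⇔ ((A □→c α) ⊃ (A □→ χ)))
  C4 : ∀ A B χ → Consistent A → ⊢ ((A □→ (B □→ χ)) ⇒ ((minusVars A B ++ B) □→ χ))
  C4b : ∀ A B χ → ⊢ (((A ++ B) □→ χ) ⇒ (A □→ (B □→ χ)))
  C5 : ∀ A ψ → Consistent A → ⊢ ((A □→ ⊥ᵖ) ⇒ ψ)
  C6 : ∀ A Y y → ⊢ ((A ++ ((Y , y) ∷ [])) □→ lit= Y y)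
  C7 : ∀ A γ → NoCF γ → ⊢ ((eqP A ∧ γ) ⇒ (A □→ γ))
  C8≥ : ∀ A α ε → ⊢ ((A □→ Pr≥ α ε) ⇔ Pr≥ (A □→c α) ε)
  C8> : ∀ A α ε → ⊢ ((A □→ Pr> α ε) ⇔ Pr> (A □→c α) ε)
  C8b≥ : ∀ A α β → ⊢ ((A □→ PrGe α β) ⇔ PrGe (A □→c α) (A □→c β))
  C8b> : ∀ A α β → ⊢ ((A □→ PrGt α β) ⇔ PrGt (A □→c α) (A □→c β))
  C9 : ∀ (Y : Var σ) (w : (v : Var σ) → Val σ v) →
       ⊢ (φEnd {σ} Y ⇒ (restrictTo (W₁ {σ} Y) w □→ ⨆ᵖ (map (lit= Y) (allFin (suc (ran σ Y))))))
  C10 : ∀ (Y : Var σ) y (w : (v : Var σ) → Val σ v) →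
       ⊢ ((φEnd {σ} Y ᶜ) ⇒ ((Y ≐ y) ⊃ (restrictTo (W₁ {σ} Y) w □→ lit= Y y)))
  C11 : ∀ (X₁ X₂ : Var σ) (Xs : List (Var σ)) →
       ⊢ (chain {σ} X₁ (X₂ ∷ Xs) ⇒ (emb (last {σ} X₂ Xs ⇝ X₁) ᶜ))
  MP : ∀ {ψ χ} → ⊢ ψ → ⊢ (ψ ⇒ χ) → ⊢ χ
  Rep : ∀ {φ φ' θ θ'} → ⊢ φ → ⊢ (θ ⇔ θ') → RepP θ θ' φ φ' → ⊢ φ'
  ⊥ω : ∀ {ψ α} → (∀ (ε : Prob) → ⊢ (ψ ⇒ Pr≠ α ε)) → ⊢ (ψ ⇒ ⊥ᵖ)
  Mon⊃ : ∀ {ψ χ} α → ⊢ (ψ ⇒ χ) → ⊢ ((α ⊃ ψ) ⇒ (α ⊃ χ))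
  →to⊃ : ∀ {α ψ} → ⊢ (emb α ⇒ ψ) → ⊢ (α ⊃ ψ)
  ⊃ω : ∀ {ψ α β} (δ : Prob) →
       (∀ (ε : Prob) → val ε ≢ 0ℚ → ⊢ (ψ ⇒ (Pr≐ (α ∧c β) (δ ·ᵖ ε) ⇔ Pr≐ α ε))) →
       ⊢ (ψ ⇒ (α ⊃ Pr≐ β δ))
  Mon□→ : ∀ {ψ χ} A → ⊢ (ψ ⇒ χ) → ⊢ ((A □→ ψ) ⇒ (A □→ χ))

module _ {σ : Signature} where

  IsProbAtom : PCO σ → Set
  IsProbAtom (Pr≥ _ _) = ⊤
  IsProbAtom (Pr> _ _) = ⊤
  IsProbAtom (PrGe _ _) = ⊤
  IsProbAtom (PrGt _ _) = ⊤
  IsProbAtom _ = ⊥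

  IsCounterfactual : PCO σ → Set
  IsCounterfactual (_ □→ _) = ⊤
  IsCounterfactual _ = ⊥

  -- (1) consequents of □→ are probabilistic atoms;
  -- (2) consequents of ⊃ are counterfactuals or probabilistic atoms.
  -- (Occurrences inside CO subformulas — antecedents of ⊃ and arguments of
  --  Pr — are not occurrences at the PCO level and are not constrained.)
  NormalForm : PCO σ → Set
  NormalForm (lit= _ _) = ⊤
  NormalForm (lit≠ _ _) = ⊤
  NormalForm (Pr≥ _ _) = ⊤
  NormalForm (Pr> _ _) = ⊤
  NormalForm (PrGe _ _) = ⊤
  NormalForm (PrGt _ _) = ⊤
  NormalForm (ψ ∧ χ) = NormalForm ψ × NormalForm χ
  NormalForm (ψ ⊔ χ) = NormalForm ψ × NormalForm χ
  NormalForm (α ⊃ χ) = (IsCounterfactual χ ⊎ IsProbAtom χ) × NormalForm χ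
  NormalForm (A □→ χ) = IsProbAtom χ × NormalForm χ

{-# OPTIONS --safe #-}
-- Literals become probabilistic atoms by P1 (Y = y ⇔ Pr(Y = y) = 1).  A conditional α ⊃ _
-- distributes over ∧ and ⊔ and absorbs a nested conditional into its antecedent (O5);
-- an intervention A □→ _ distributes over ∧, ⊔ and ⊃ (C1–C3) and is absorbed into the
-- CO arguments of a probabilistic atom (C8).  Pushing both inwards turns every formula into
-- one built from probabilistic atoms by ∧, ⊔ and α ⊃ atom, which has no □→ at the PCO level
-- at all and is therefore in normal form.  The propositional steps in between are instances
-- of T1, recognised by truth tables.
module Submission where

open import Defs
open import Data.Bool using (Bool; true; false; T; not) renaming (_∧_ to _and_; _∨_ to _or_)
open import Data.Bool.Properties using (T-∧; T-≡)
open import Data.List using (List; []; _∷_; _++_)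
open import Data.List.Membership.Propositional using (_∈_; _∉_)
open import Data.List.Membership.Propositional.Properties using (∈-++⁺ˡ; ∈-++⁺ʳ)
open import Data.List.Relation.Unary.Any using (here; there)
open import Data.Nat using (ℕ; zero; suc; _≟_)
open import Data.Product using (Σ; _×_; _,_; proj₁; proj₂)
open import Data.Sum using (inj₂)
open import Data.Unit using (tt)
open import Function.Bundles using (Equivalence)
open import Relation.Nullary using (yes; no; contradiction)
open import Relation.Binary.PropositionalEquality using (_≡_; refl; sym; cong; cong₂; subst)

varsOf : Prop₁ → List ℕ
varsOf (pv i)   = i ∷ []
varsOf (F p∧ G) = varsOf F ++ varsOf G
varsOf (F p⊔ G) = varsOf F ++ varsOf G
varsOf (F p→ G) = varsOf F ++ varsOf G
varsOf (pC F)   = varsOf F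
varsOf p⊤       = []
varsOf p⊥       = []

ev₁-local : ∀ F {v w : ℕ → Bool} → (∀ {i} → i ∈ varsOf F → v i ≡ w i) → ev₁ v F ≡ ev₁ w F
ev₁-local (pv i)   agree = agree (here refl)
ev₁-local (F p∧ G) agree = cong₂ _and_
  (ev₁-local F (λ i∈ → agree (∈-++⁺ˡ i∈))) (ev₁-local G (λ i∈ → agree (∈-++⁺ʳ (varsOf F) i∈)))
ev₁-local (F p⊔ G) agree = cong₂ _or_
  (ev₁-local F (λ i∈ → agree (∈-++⁺ˡ i∈))) (ev₁-local G (λ i∈ → agree (∈-++⁺ʳ (varsOf F) i∈)))
ev₁-local (F p→ G) agree = cong₂ (λ a b → not a or b)
  (ev₁-local F (λ i∈ → agree (∈-++⁺ˡ i∈))) (ev₁-local G (λ i∈ → agree (∈-++⁺ʳ (varsOf F) i∈)))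
ev₁-local (pC F)   agree = cong not (ev₁-local F agree)
ev₁-local p⊤       _     = refl
ev₁-local p⊥       _     = refl

_[_≔_] : (ℕ → Bool) → ℕ → Bool → ℕ → Bool
(v [ i ≔ b ]) j with j ≟ i
... | yes _ = b
... | no _  = v j

truthTable : List ℕ → (ℕ → Bool) → Prop₁ → Bool
truthTable []       v F = ev₁ v F
truthTable (i ∷ is) v F = truthTable is (v [ i ≔ true ]) F and truthTable is (v [ i ≔ false ]) F

T-∧-pick : ∀ (f : Bool → Bool) b → T (f true and f false) → T (f b)
T-∧-pick f true  t = proj₁ (Equivalence.to T-∧ t)
T-∧-pick f false t = proj₂ (Equivalence.to T-∧ t)

agree-[≔] : ∀ {w v : ℕ → Bool} {i is j} → (j ∉ i ∷ is → w j ≡ v j) → j ∉ is → w j ≡ (v [ i ≔ w i ]) j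
agree-[≔] {i = i} {j = j} agree j∉is with j ≟ i
... | yes refl = refl
... | no j≢i   = agree λ { (here j≡i) → j≢i j≡i ; (there j∈is) → j∉is j∈is }

truthTable-sound : ∀ is v F → T (truthTable is v F) →
                   ∀ w → (∀ {j} → j ∈ varsOf F → j ∉ is → w j ≡ v j) → T (ev₁ w F)
truthTable-sound []       v F table w agree =
  subst T (ev₁-local F (λ j∈ → sym (agree j∈ λ ()))) table
truthTable-sound (i ∷ is) v F table w agree =
  truthTable-sound is (v [ i ≔ w i ]) F (T-∧-pick (λ b → truthTable is (v [ i ≔ b ]) F) (w i) table) w
    (λ j∈ → agree-[≔] (agree j∈))

byTruthTable : ∀ F → T (truthTable (varsOf F) (λ _ → false) F) → Taut₁ F
byTruthTable F table w =
  Equivalence.to T-≡ (truthTable-sound (varsOf F) _ F table w (λ j∈ j∉ → contradiction j∈ j∉))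

_⇔₁_ : Prop₁ → Prop₁ → Prop₁
F ⇔₁ G = (F p→ G) p∧ (G p→ F)

module _ {σ : Signature} where

  instantiate : List (PCO σ) → ℕ → PCO σ
  instantiate []       _       = ⊤ᵖ
  instantiate (φ ∷ _)  zero    = φ
  instantiate (_ ∷ φs) (suc i) = instantiate φs i

  -- The implicit truth-table check evaluates to T true = ⊤, so call sites leave it to unification.
  tautology : ∀ F (φs : List (PCO σ)) → {T (truthTable (varsOf F) (λ _ → false) F)} →
              ⊢ inst₁ (instantiate φs) F
  tautology F φs {table} = T1 F (instantiate φs) (byTruthTable F table)

  ⇔-refl : ∀ φ → ⊢ (φ ⇔ φ)
  ⇔-refl φ = tautology (pv 0 ⇔₁ pv 0) (φ ∷ [])

  ⇔-to : ∀ {φ ψ} → ⊢ (φ ⇔ ψ) → ⊢ (φ ⇒ ψ)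
  ⇔-to {φ} {ψ} φ⇔ψ = MP φ⇔ψ (tautology ((pv 0 ⇔₁ pv 1) p→ (pv 0 p→ pv 1)) (φ ∷ ψ ∷ []))

  ⇔-from : ∀ {φ ψ} → ⊢ (φ ⇔ ψ) → ⊢ (ψ ⇒ φ)
  ⇔-from {φ} {ψ} φ⇔ψ = MP φ⇔ψ (tautology ((pv 0 ⇔₁ pv 1) p→ (pv 1 p→ pv 0)) (φ ∷ ψ ∷ []))

  mk⇔ : ∀ {φ ψ} → ⊢ (φ ⇒ ψ) → ⊢ (ψ ⇒ φ) → ⊢ (φ ⇔ ψ)
  mk⇔ {φ} {ψ} φ⇒ψ ψ⇒φ =
    MP ψ⇒φ (MP φ⇒ψ (tautology ((pv 0 p→ pv 1) p→ ((pv 1 p→ pv 0) p→ (pv 0 ⇔₁ pv 1))) (φ ∷ ψ ∷ [])))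

  ⇔-trans : ∀ {φ ψ χ} → ⊢ (φ ⇔ ψ) → ⊢ (ψ ⇔ χ) → ⊢ (φ ⇔ χ)
  ⇔-trans {φ} {ψ} {χ} φ⇔ψ ψ⇔χ =
    MP ψ⇔χ (MP φ⇔ψ (tautology ((pv 0 ⇔₁ pv 1) p→ ((pv 1 ⇔₁ pv 2) p→ (pv 0 ⇔₁ pv 2))) (φ ∷ ψ ∷ χ ∷ [])))

  ∧-cong : ∀ {φ φ′ ψ ψ′} → ⊢ (φ ⇔ φ′) → ⊢ (ψ ⇔ ψ′) → ⊢ ((φ ∧ ψ) ⇔ (φ′ ∧ ψ′))
  ∧-cong {φ} {φ′} {ψ} {ψ′} φ⇔φ′ ψ⇔ψ′ =
    MP ψ⇔ψ′ (MP φ⇔φ′ (tautology ((pv 0 ⇔₁ pv 1) p→ ((pv 2 ⇔₁ pv 3) p→ ((pv 0 p∧ pv 2) ⇔₁ (pv 1 p∧ pv 3))))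
                                 (φ ∷ φ′ ∷ ψ ∷ ψ′ ∷ [])))

  ⊔-cong : ∀ {φ φ′ ψ ψ′} → ⊢ (φ ⇔ φ′) → ⊢ (ψ ⇔ ψ′) → ⊢ ((φ ⊔ ψ) ⇔ (φ′ ⊔ ψ′))
  ⊔-cong {φ} {φ′} {ψ} {ψ′} φ⇔φ′ ψ⇔ψ′ =
    MP ψ⇔ψ′ (MP φ⇔φ′ (tautology ((pv 0 ⇔₁ pv 1) p→ ((pv 2 ⇔₁ pv 3) p→ ((pv 0 p⊔ pv 2) ⇔₁ (pv 1 p⊔ pv 3))))
                                 (φ ∷ φ′ ∷ ψ ∷ ψ′ ∷ [])))

  ⊃-cong : ∀ α {φ φ′} → ⊢ (φ ⇔ φ′) → ⊢ ((α ⊃ φ) ⇔ (α ⊃ φ′))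
  ⊃-cong α φ⇔φ′ = mk⇔ (Mon⊃ α (⇔-to φ⇔φ′)) (Mon⊃ α (⇔-from φ⇔φ′))

  □→-cong : ∀ A {φ φ′} → ⊢ (φ ⇔ φ′) → ⊢ ((A □→ φ) ⇔ (A □→ φ′))
  □→-cong A φ⇔φ′ = mk⇔ (Mon□→ A (⇔-to φ⇔φ′)) (Mon□→ A (⇔-from φ⇔φ′))

  condition : CO σ → PCO σ → PCO σ
  condition α (φ ∧ ψ) = condition α φ ∧ condition α ψ
  condition α (φ ⊔ ψ) = condition α φ ⊔ condition α ψ
  condition α (β ⊃ φ) = condition (α ∧c β) φ
  condition α φ       = α ⊃ φ

  intervene : Asg σ → PCO σ → PCO σ
  intervene A (Pr≥ α ε)  = Pr≥ (A □→c α) ε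
  intervene A (Pr> α ε)  = Pr> (A □→c α) ε
  intervene A (PrGe α β) = PrGe (A □→c α) (A □→c β)
  intervene A (PrGt α β) = PrGt (A □→c α) (A □→c β)
  intervene A (φ ∧ ψ)    = intervene A φ ∧ intervene A ψ
  intervene A (φ ⊔ ψ)    = intervene A φ ⊔ intervene A ψ
  intervene A (β ⊃ φ)    = (A □→c β) ⊃ intervene A φ
  intervene A φ          = A □→ φ

  normalise : PCO σ → PCO σ
  normalise (lit= Y y) = Pr≐ (Y ≐ y) p1
  normalise (lit≠ Y y) = Pr≐ (Y ≠̇ y) p1
  normalise (φ ∧ ψ)    = normalise φ ∧ normalise ψ
  normalise (φ ⊔ ψ)    = normalise φ ⊔ normalise ψ
  normalise (α ⊃ φ)    = condition α (normalise φ)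
  normalise (A □→ φ)   = intervene A (normalise φ)
  normalise (Pr≥ α ε)  = Pr≥ α ε
  normalise (Pr> α ε)  = Pr> α ε
  normalise (PrGe α β) = PrGe α β
  normalise (PrGt α β) = PrGt α β

  condition-sound : ∀ α φ → ⊢ ((α ⊃ φ) ⇔ condition α φ)
  condition-sound α (φ ∧ ψ)    = ⇔-trans (O5∧ α φ ψ) (∧-cong (condition-sound α φ) (condition-sound α ψ))
  condition-sound α (φ ⊔ ψ)    = ⇔-trans (O5⊔ α φ ψ) (⊔-cong (condition-sound α φ) (condition-sound α ψ))
  condition-sound α (β ⊃ φ)    = ⇔-trans (O5⊃ α β φ) (condition-sound (α ∧c β) φ)
  condition-sound α (lit= _ _) = ⇔-refl _
  condition-sound α (lit≠ _ _) = ⇔-refl _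
  condition-sound α (Pr≥ _ _)  = ⇔-refl _
  condition-sound α (Pr> _ _)  = ⇔-refl _
  condition-sound α (PrGe _ _) = ⇔-refl _
  condition-sound α (PrGt _ _) = ⇔-refl _
  condition-sound α (_ □→ _)   = ⇔-refl _

  intervene-sound : ∀ A φ → ⊢ ((A □→ φ) ⇔ intervene A φ)
  intervene-sound A (Pr≥ α ε)  = C8≥ A α ε
  intervene-sound A (Pr> α ε)  = C8> A α ε
  intervene-sound A (PrGe α β) = C8b≥ A α β
  intervene-sound A (PrGt α β) = C8b> A α β
  intervene-sound A (φ ∧ ψ)    = ⇔-trans (C1 A φ ψ) (∧-cong (intervene-sound A φ) (intervene-sound A ψ))
  intervene-sound A (φ ⊔ ψ)    = ⇔-trans (C2 A φ ψ) (⊔-cong (intervene-sound A φ) (intervene-sound A ψ))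
  intervene-sound A (β ⊃ φ)    = ⇔-trans (C3 A β φ) (⊃-cong (A □→c β) (intervene-sound A φ))
  intervene-sound A (lit= _ _) = ⇔-refl _
  intervene-sound A (lit≠ _ _) = ⇔-refl _
  intervene-sound A (_ □→ _)   = ⇔-refl _

  normalise-sound : ∀ φ → ⊢ (φ ⇔ normalise φ)
  normalise-sound (lit= Y y) = P1 (Y ≐ y)
  normalise-sound (lit≠ Y y) = P1 (Y ≠̇ y)
  normalise-sound (φ ∧ ψ)    = ∧-cong (normalise-sound φ) (normalise-sound ψ)
  normalise-sound (φ ⊔ ψ)    = ⊔-cong (normalise-sound φ) (normalise-sound ψ)
  normalise-sound (α ⊃ φ)    = ⇔-trans (⊃-cong α (normalise-sound φ)) (condition-sound α (normalise φ))
  normalise-sound (A □→ φ)   = ⇔-trans (□→-cong A (normalise-sound φ)) (intervene-sound A (normalise φ))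
  normalise-sound (Pr≥ _ _)  = ⇔-refl _
  normalise-sound (Pr> _ _)  = ⇔-refl _
  normalise-sound (PrGe _ _) = ⇔-refl _
  normalise-sound (PrGt _ _) = ⇔-refl _

  data ProbAtom : PCO σ → Set where
    ≥ε  : ∀ α ε → ProbAtom (Pr≥ α ε)
    >ε  : ∀ α ε → ProbAtom (Pr> α ε)
    ≥Pr : ∀ α β → ProbAtom (PrGe α β)
    >Pr : ∀ α β → ProbAtom (PrGt α β)

  data ProbCombination : PCO σ → Set where
    atom  : ∀ {φ} → ProbAtom φ → ProbCombination φ
    conj  : ∀ {φ ψ} → ProbCombination φ → ProbCombination ψ → ProbCombination (φ ∧ ψ)
    disj  : ∀ {φ ψ} → ProbCombination φ → ProbCombination ψ → ProbCombination (φ ⊔ ψ)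
    given : ∀ α {φ} → ProbAtom φ → ProbCombination (α ⊃ φ)

  intervene-atom : ∀ A {φ} → ProbAtom φ → ProbAtom (intervene A φ)
  intervene-atom A (≥ε α ε)  = ≥ε _ ε
  intervene-atom A (>ε α ε)  = >ε _ ε
  intervene-atom A (≥Pr α β) = ≥Pr _ _
  intervene-atom A (>Pr α β) = >Pr _ _

  condition-atom : ∀ α {φ} → ProbAtom φ → ProbCombination (condition α φ)
  condition-atom α a@(≥ε _ _)  = given α a
  condition-atom α a@(>ε _ _)  = given α a
  condition-atom α a@(≥Pr _ _) = given α a
  condition-atom α a@(>Pr _ _) = given α a

  condition-combination : ∀ α {φ} → ProbCombination φ → ProbCombination (condition α φ)
  condition-combination α (atom a)    = condition-atom α a
  condition-combination α (conj p q)  = conj (condition-combination α p) (condition-combination α q)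
  condition-combination α (disj p q)  = disj (condition-combination α p) (condition-combination α q)
  condition-combination α (given β a) = condition-atom (α ∧c β) a

  intervene-combination : ∀ A {φ} → ProbCombination φ → ProbCombination (intervene A φ)
  intervene-combination A (atom a)    = atom (intervene-atom A a)
  intervene-combination A (conj p q)  = conj (intervene-combination A p) (intervene-combination A q)
  intervene-combination A (disj p q)  = disj (intervene-combination A p) (intervene-combination A q)
  intervene-combination A (given β a) = given (A □→c β) (intervene-atom A a)

  normalise-combination : ∀ φ → ProbCombination (normalise φ)
  normalise-combination (lit= Y y) = conj (atom (≥ε _ _)) (atom (≥ε _ _))
  normalise-combination (lit≠ Y y) = conj (atom (≥ε _ _)) (atom (≥ε _ _))
  normalise-combination (Pr≥ α ε)  = atom (≥ε α ε)
  normalise-combination (Pr> α ε)  = atom (>ε α ε)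
  normalise-combination (PrGe α β) = atom (≥Pr α β)
  normalise-combination (PrGt α β) = atom (>Pr α β)
  normalise-combination (φ ∧ ψ)    = conj (normalise-combination φ) (normalise-combination ψ)
  normalise-combination (φ ⊔ ψ)    = disj (normalise-combination φ) (normalise-combination ψ)
  normalise-combination (α ⊃ φ)    = condition-combination α (normalise-combination φ)
  normalise-combination (A □→ φ)   = intervene-combination A (normalise-combination φ)

  probAtom-normal : ∀ {φ} → ProbAtom φ → IsProbAtom φ × NormalForm φ
  probAtom-normal (≥ε _ _)  = tt , tt
  probAtom-normal (>ε _ _)  = tt , tt
  probAtom-normal (≥Pr _ _) = tt , tt
  probAtom-normal (>Pr _ _) = tt , tt

  probCombination-normal : ∀ {φ} → ProbCombination φ → NormalForm φ
  probCombination-normal (atom a)    = proj₂ (probAtom-normal a)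
  probCombination-normal (conj p q)  = probCombination-normal p , probCombination-normal q
  probCombination-normal (disj p q)  = probCombination-normal p , probCombination-normal q
  probCombination-normal (given α a) = inj₂ (proj₁ (probAtom-normal a)) , proj₂ (probAtom-normal a)

mainTheorem6 : (σ : Signature) (φ : PCO σ) →
    Σ (PCO σ) (λ φ' → (⊢ (φ ⇔ φ')) × NormalForm φ')
mainTheorem6 σ φ = normalise φ , normalise-sound φ , probCombination-normal (normalise-combination φ)
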